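{- For all $n\ge0$, $b_{2n+1}=(2n+1)b_{2n}$, where $b_k$ denotes the number of permutations of $[k]$ all of whose peaks and valleys are even.
   Context: For a permutation $\pi=\pi_1\cdots\pi_k$, an index $i$ ($2\le i\le k-1$) is a peak if $\pi_{i-1}<\pi_i>\pi_{i+1}$ and a valley if $\pi_{i-1}>\pi_i<\pi_{i+1}$. $b_0=1$. -}

module Defs where

open import Data.Nat using (ℕ; zero; suc; _+_; _*_; _∸_; _≤_; _<_; _≤?_; _<?_)
open import Data.Nat.Properties using (_≟_)
open import Data.Nat.Divisibility using (_∣_; _∣?_)
open import Data.List using (List; []; _∷_; [_]; length; map; concatMap; upTo; filter)
open import Data.List.Relation.Unary.All using (All; all?)
import Data.List.Relation.Unary.Unique.DecPropositional as UniqueDec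
open import Data.Product using (_×_)
open import Data.Sum using (_⊎_)
open import Relation.Nullary using (Dec; _×-dec_; _⊎-dec_; _→-dec_)

open UniqueDec _≟_ using (Unique; unique?)

range : ℕ → List ℕ
range k = map suc (upTo k)

words : ℕ → ℕ → List (List ℕ)
words k zero      = [ [] ]
words k (suc len) = concatMap (λ x → map (x ∷_) (words k len)) (range k)

-- a permutation of [k], in one-line notation π₁⋯π_k, is a word of length k
-- over [k] with pairwise distinct letters
perms : ℕ → List (List ℕ)
perms k = filter (λ w → unique? w) (words k k)

-- 1-indexed access: entry π i = π_i (for 1 ≤ i ≤ length π; 0 otherwise)
entry : List ℕ → ℕ → ℕ
entry []       _             = 0
entry (x ∷ xs) zero          = 0
entry (x ∷ xs) (suc zero)    = x
entry (x ∷ xs) (suc (suc i)) = entry xs (suc i)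

Interior : List ℕ → ℕ → Set
Interior π i = (2 ≤ i) × (suc i ≤ length π)

IsPeak : List ℕ → ℕ → Set
IsPeak π i = Interior π i × (entry π (i ∸ 1) < entry π i) × (entry π (suc i) < entry π i)

IsValley : List ℕ → ℕ → Set
IsValley π i = Interior π i × (entry π i < entry π (i ∸ 1)) × (entry π i < entry π (suc i))

Even : ℕ → Set
Even i = 2 ∣ i

AllPVEven : List ℕ → Set
AllPVEven π = All (λ i → IsPeak π i ⊎ IsValley π i → Even i) (range (length π))

interior? : ∀ π i → Dec (Interior π i)
interior? π i = (2 ≤? i) ×-dec (suc i ≤? length π)

isPeak? : ∀ π i → Dec (IsPeak π i)
isPeak? π i = interior? π i ×-dec (entry π (i ∸ 1) <? entry π i) ×-dec (entry π (suc i) <? entry π i)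

isValley? : ∀ π i → Dec (IsValley π i)
isValley? π i = interior? π i ×-dec (entry π i <? entry π (i ∸ 1)) ×-dec (entry π i <? entry π (suc i))

allPVEven? : ∀ π → Dec (AllPVEven π)
allPVEven? π = all? (λ i → (isPeak? π i ⊎-dec isValley? π i) →-dec (2 ∣? i)) (range (length π))

b : ℕ → ℕ
b k = length (filter allPVEven? (perms k))

-- Write a permutation π of [m+1] as σ′ followed by its last letter v, and standardise
-- σ′ to a permutation σ of [m].  Standardising preserves relative order, so a position
-- 2,…,m-1 is a peak or valley of π exactly when it is one of σ; position m+1 never is,
-- and position m is even when m is.  Hence for even m the map π ↦ (v, σ) is a
-- bijection onto [m+1] × {σ counted by b m}, and b (m+1) = (m+1) · b m.
module Submission where

open import Defs
open import Data.Empty using (⊥-elim)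
open import Data.List
  using (List; []; _∷_; [_]; _++_; _∷ʳ_; length; map; concatMap; filter; upTo;
         cartesianProductWith; initLast; _∷ʳ′_)
open import Data.List.Properties
  using (length-map; length-++; length-upTo; map-injective; ∷-injective; ∷ʳ-injective)
open import Data.List.Membership.Propositional using (_∈_)
open import Data.List.Membership.Propositional.Properties
  using (∈-map⁺; ∈-map⁻; ∈-upTo⁺; ∈-upTo⁻; ∈-filter⁺; ∈-filter⁻;
         ∈-cartesianProductWith⁺; ∈-cartesianProductWith⁻)
open import Data.List.Membership.Propositional.Properties.WithK using (unique∧set⇒bag)
open import Data.List.Relation.Binary.BagAndSetEquality using (∼bag⇒↭)
open import Data.List.Relation.Binary.Permutation.Propositional.Properties using (↭-length)
open import Data.List.Relation.Unary.All as All using (All; []; _∷_)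
import Data.List.Relation.Unary.All.Properties as All
open import Data.List.Relation.Unary.AllPairs using ([]; _∷_)
open import Data.List.Relation.Unary.Any using (here)
open import Data.List.Relation.Unary.Unique.Propositional using (Unique)
import Data.List.Relation.Unary.Unique.Propositional.Properties as Unique
import Data.List.Relation.Unary.Unique.DecPropositional as UniqueDec
open import Data.Nat using (ℕ; zero; suc; pred; _+_; _*_; _∸_; _≤_; _<_; z≤n; s≤s)
open import Data.Nat.Divisibility using (m∣m*n)
open import Data.Nat.Properties
  using (_≟_; ≤-refl; ≤-trans; ≤-pred; n≤1+n; m∸n≤m; ≤∧≢⇒<; suc-injective; +-comm)
open import Data.Product using (_×_; _,_; proj₁; proj₂; ∃₂)
import Data.Sum as Sum
open import Data.Sum using (_⊎_; inj₁; inj₂)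
open import Function.Bundles using (_⇔_; mk⇔; Equivalence)
open import Relation.Binary.PropositionalEquality
  using (_≡_; _≢_; refl; sym; trans; cong; cong₂; subst; subst₂; module ≡-Reasoning)
open import Relation.Nullary using (yes; no)

open UniqueDec _≟_ using (unique?)

-- punchIn v x = x for x < v and suc x for x ≥ v; punchOut v inverts it off v.
punchIn : ℕ → ℕ → ℕ
punchIn zero    x       = suc x
punchIn (suc v) zero    = zero
punchIn (suc v) (suc x) = suc (punchIn v x)

punchOut : ℕ → ℕ → ℕ
punchOut zero    x       = pred x
punchOut (suc v) zero    = zero
punchOut (suc v) (suc x) = suc (punchOut v x)

punchIn-mono-< : ∀ v {x y} → x < y → punchIn v x < punchIn v y
punchIn-mono-< zero    x<y                      = s≤s x<y
punchIn-mono-< (suc v) {zero}  {suc y} _        = s≤s z≤n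
punchIn-mono-< (suc v) {suc x} {suc y} (s≤s x<y) = s≤s (punchIn-mono-< v x<y)

punchIn-cancel-< : ∀ v {x y} → punchIn v x < punchIn v y → x < y
punchIn-cancel-< zero    (s≤s x<y)              = x<y
punchIn-cancel-< (suc v) {zero}  {suc y} _      = s≤s z≤n
punchIn-cancel-< (suc v) {suc x} {suc y} (s≤s p) = s≤s (punchIn-cancel-< v p)

punchIn-injective : ∀ v {x y} → punchIn v x ≡ punchIn v y → x ≡ y
punchIn-injective zero    refl               = refl
punchIn-injective (suc v) {zero}  {zero}  _  = refl
punchIn-injective (suc v) {suc x} {suc y} eq = cong suc (punchIn-injective v (suc-injective eq))

punchIn-zero : ∀ {v} → 1 ≤ v → punchIn v 0 ≡ 0
punchIn-zero {suc v} _ = refl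

punchInᵥ≢v : ∀ v x → punchIn v x ≢ v
punchInᵥ≢v (suc v) (suc x) eq = punchInᵥ≢v v x (suc-injective eq)

punchIn-punchOut : ∀ {v x} → x ≢ v → punchIn v (punchOut v x) ≡ x
punchIn-punchOut {zero}  {zero}  x≢v = ⊥-elim (x≢v refl)
punchIn-punchOut {zero}  {suc x} _   = refl
punchIn-punchOut {suc v} {zero}  _   = refl
punchIn-punchOut {suc v} {suc x} x≢v = cong suc (punchIn-punchOut (λ eq → x≢v (cong suc eq)))

map-punchIn-punchOut : ∀ {v xs} → All (_≢ v) xs → map (punchIn v) (map (punchOut v) xs) ≡ xs
map-punchIn-punchOut []           = refl
map-punchIn-punchOut (x≢v ∷ xs≢v) = cong₂ _∷_ (punchIn-punchOut x≢v) (map-punchIn-punchOut xs≢v)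

x≤punchIn : ∀ v x → x ≤ punchIn v x
x≤punchIn zero    x       = n≤1+n x
x≤punchIn (suc v) zero    = z≤n
x≤punchIn (suc v) (suc x) = s≤s (x≤punchIn v x)

punchIn≤suc : ∀ v x → punchIn v x ≤ suc x
punchIn≤suc zero    x       = ≤-refl
punchIn≤suc (suc v) zero    = z≤n
punchIn≤suc (suc v) (suc x) = s≤s (punchIn≤suc v x)

punchOut≤ : ∀ k {v x} → v ≤ suc k → x ≤ suc k → x ≢ v → punchOut v x ≤ k
punchOut≤ k       {zero}  {zero}  _ _         _ = z≤n
punchOut≤ k       {zero}  {suc x} _ (s≤s x≤k) _ = x≤k
punchOut≤ k       {suc v} {zero}  _ _         _ = z≤n
punchOut≤ zero    {suc v} {suc x} (s≤s z≤n) (s≤s z≤n) x≢v = ⊥-elim (x≢v refl)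
punchOut≤ (suc k) {suc v} {suc x} (s≤s v≤) (s≤s x≤) x≢v =
  s≤s (punchOut≤ k v≤ x≤ (λ eq → x≢v (cong suc eq)))

length-cartesianProductWith : ∀ {A B C : Set} (f : A → B → C) xs ys →
  length (cartesianProductWith f xs ys) ≡ length xs * length ys
length-cartesianProductWith f []       ys = refl
length-cartesianProductWith f (x ∷ xs) ys = begin
  length (map (f x) ys ++ cartesianProductWith f xs ys)
    ≡⟨ length-++ (map (f x) ys) ⟩
  length (map (f x) ys) + length (cartesianProductWith f xs ys)
    ≡⟨ cong₂ _+_ (length-map (f x) ys) (length-cartesianProductWith f xs ys) ⟩
  length ys + length xs * length ys ∎
  where open ≡-Reasoning

length-cong-unique : ∀ {A : Set} {xs ys : List A} → Unique xs → Unique ys →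
                     (∀ {z} → z ∈ xs ⇔ z ∈ ys) → length xs ≡ length ys
length-cong-unique u v xs⇔ys = ↭-length (∼bag⇒↭ (unique∧set⇒bag u v xs⇔ys))

concatMap-map≡cartesianProductWith : ∀ {A B C : Set} (f : A → B → C) xs ys →
  concatMap (λ x → map (f x) ys) xs ≡ cartesianProductWith f xs ys
concatMap-map≡cartesianProductWith f []       ys = refl
concatMap-map≡cartesianProductWith f (x ∷ xs) ys =
  cong (map (f x) ys ++_) (concatMap-map≡cartesianProductWith f xs ys)

unique-∷ʳ⁺ : ∀ {A : Set} {xs : List A} {v} → Unique xs → All (_≢ v) xs → Unique (xs ∷ʳ v)
unique-∷ʳ⁺ []             []           = [] ∷ []
unique-∷ʳ⁺ (x∉xs ∷ xs!) (x≢v ∷ xs≢v) = All.∷ʳ⁺ x∉xs x≢v ∷ unique-∷ʳ⁺ xs! xs≢v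

unique-∷ʳ⁻ : ∀ {A : Set} (xs : List A) {v} → Unique (xs ∷ʳ v) → Unique xs × All (_≢ v) xs
unique-∷ʳ⁻ []       _            = [] , []
unique-∷ʳ⁻ (x ∷ xs) (x∉ ∷ xsv!) with x∉xs , x≢v ← All.∷ʳ⁻ x∉ | xs! , xs≢v ← unique-∷ʳ⁻ xs xsv! =
  x∉xs ∷ xs! , x≢v ∷ xs≢v

∈-range⁺ : ∀ {k x} → 1 ≤ x → x ≤ k → x ∈ range k
∈-range⁺ {x = suc x} _ x≤k = ∈-map⁺ suc (∈-upTo⁺ x≤k)

∈-range⁻ : ∀ {k x} → x ∈ range k → 1 ≤ x × x ≤ k
∈-range⁻ x∈ with _ , y∈ , refl ← ∈-map⁻ suc x∈ = s≤s z≤n , ∈-upTo⁻ y∈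

range-unique : ∀ k → Unique (range k)
range-unique k = Unique.map⁺ suc-injective (Unique.upTo⁺ k)

length-range : ∀ k → length (range k) ≡ k
length-range k = trans (length-map suc (upTo k)) (length-upTo k)

punchIn-∈-range : ∀ {k} v {x} → x ∈ range k → punchIn v x ∈ range (suc k)
punchIn-∈-range v {x} x∈ with 1≤x , x≤k ← ∈-range⁻ x∈ =
  ∈-range⁺ (≤-trans 1≤x (x≤punchIn v x)) (≤-trans (punchIn≤suc v x) (s≤s x≤k))

punchOut-∈-range : ∀ {k v x} → v ∈ range (suc k) → x ∈ range (suc k) → x ≢ v →
                   punchOut v x ∈ range k
punchOut-∈-range {k} v∈ x∈ x≢v with ∈-range⁻ v∈ | ∈-range⁻ x∈
... | s≤s z≤n , v≤ | s≤s z≤n , x≤ = ∈-range⁺ (s≤s z≤n) (punchOut≤ k v≤ x≤ x≢v)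

words-suc : ∀ k len → words k (suc len) ≡ cartesianProductWith _∷_ (range k) (words k len)
words-suc k len = concatMap-map≡cartesianProductWith _∷_ (range k) (words k len)

∈-words⁺ : ∀ {k len π} → length π ≡ len → All (_∈ range k) π → π ∈ words k len
∈-words⁺ {len = zero}  {[]}    _   []          = here refl
∈-words⁺ {k} {suc len} {x ∷ π} |π| (x∈ ∷ π⊆) rewrite words-suc k len =
  ∈-cartesianProductWith⁺ _∷_ x∈ (∈-words⁺ (suc-injective |π|) π⊆)

∈-words⁻ : ∀ {k} len {π} → π ∈ words k len → length π ≡ len × All (_∈ range k) π
∈-words⁻ zero (here refl) = refl , []
∈-words⁻ {k} (suc len) π∈ rewrite words-suc k len
  with _ , _ , x∈ , σ∈ , refl ← ∈-cartesianProductWith⁻ _∷_ (range k) (words k len) π∈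
  with |σ| , σ⊆ ← ∈-words⁻ len σ∈ = cong suc |σ| , x∈ ∷ σ⊆

words-unique : ∀ k len → Unique (words k len)
words-unique k zero      = [] ∷ []
words-unique k (suc len) rewrite words-suc k len =
  Unique.cartesianProductWith⁺ _∷_ ∷-injective (range-unique k) (words-unique k len)

IsPermutation : ℕ → List ℕ → Set
IsPermutation k π = length π ≡ k × All (_∈ range k) π × Unique π

∈-perms⁺ : ∀ {k π} → IsPermutation k π → π ∈ perms k
∈-perms⁺ (|π| , π⊆ , π!) = ∈-filter⁺ (λ w → unique? w) (∈-words⁺ |π| π⊆) π!

∈-perms⁻ : ∀ {k π} → π ∈ perms k → IsPermutation k π
∈-perms⁻ {k} π∈ with π∈words , π! ← ∈-filter⁻ (λ w → unique? w) π∈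
  with |π| , π⊆ ← ∈-words⁻ k π∈words = |π| , π⊆ , π!

perms-unique : ∀ k → Unique (perms k)
perms-unique k = Unique.filter⁺ (λ w → unique? w) (words-unique k k)

PeakOrValley : List ℕ → ℕ → Set
PeakOrValley π i = IsPeak π i ⊎ IsValley π i

PeaksValleysEven : List ℕ → Set
PeaksValleysEven π = ∀ i → PeakOrValley π i → Even i

peakOrValley⇒interior : ∀ {π i} → PeakOrValley π i → Interior π i
peakOrValley⇒interior (inj₁ (interior , _)) = interior
peakOrValley⇒interior (inj₂ (interior , _)) = interior

allPVEven⇔peaksValleysEven : ∀ π → AllPVEven π ⇔ PeaksValleysEven π
allPVEven⇔peaksValleysEven π = mk⇔
  (λ all i pv → All.lookup all (i∈ (peakOrValley⇒interior {π} pv)) pv)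
  (λ pvEven → All.tabulate (λ {i} _ → pvEven i))
  where
  i∈ : ∀ {i} → Interior π i → i ∈ range (length π)
  i∈ {i} (2≤i , i<|π|) = ∈-range⁺ (≤-trans (s≤s z≤n) 2≤i) (≤-trans (n≤1+n i) i<|π|)

pvEvenPerms : ℕ → List (List ℕ)
pvEvenPerms k = filter allPVEven? (perms k)

∈-pvEvenPerms⁺ : ∀ {k π} → IsPermutation k π → PeaksValleysEven π → π ∈ pvEvenPerms k
∈-pvEvenPerms⁺ {π = π} perm pvEven =
  ∈-filter⁺ allPVEven? (∈-perms⁺ perm) (Equivalence.from (allPVEven⇔peaksValleysEven π) pvEven)

∈-pvEvenPerms⁻ : ∀ {k π} → π ∈ pvEvenPerms k → IsPermutation k π × PeaksValleysEven π
∈-pvEvenPerms⁻ {π = π} π∈ with π∈perms , all ← ∈-filter⁻ allPVEven? π∈ =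
  ∈-perms⁻ π∈perms , Equivalence.to (allPVEven⇔peaksValleysEven π) all

pvEvenPerms-unique : ∀ k → Unique (pvEvenPerms k)
pvEvenPerms-unique k = Unique.filter⁺ allPVEven? (perms-unique k)

entry-zero : ∀ xs → entry xs 0 ≡ 0
entry-zero []      = refl
entry-zero (_ ∷ _) = refl

entry-++ˡ : ∀ xs ys {j} → j ≤ length xs → entry (xs ++ ys) j ≡ entry xs j
entry-++ˡ []       ys {zero}        _         = entry-zero ys
entry-++ˡ (x ∷ xs) ys {zero}        _         = refl
entry-++ˡ (x ∷ xs) ys {suc zero}    _         = refl
entry-++ˡ (x ∷ xs) ys {suc (suc j)} (s≤s j≤) = entry-++ˡ xs ys j≤

entry-map : ∀ {f} → f 0 ≡ 0 → ∀ xs j → entry (map f xs) j ≡ f (entry xs j)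
entry-map f0 []       j             = sym f0
entry-map f0 (x ∷ xs) zero          = sym f0
entry-map f0 (x ∷ xs) (suc zero)    = refl
entry-map f0 (x ∷ xs) (suc (suc j)) = entry-map f0 xs (suc j)

peakOrValley-transport : ∀ σ τ m → m ≤ length τ →
  (∀ {j k} → j ≤ m → k ≤ m → entry σ j < entry σ k → entry τ j < entry τ k) →
  ∀ {i} → suc i ≤ m → PeakOrValley σ i → PeakOrValley τ i
peakOrValley-transport σ τ m m≤|τ| mono {i} i<m = Sum.map
  (λ { ((2≤i , _) , left , right) → (2≤i , i<|τ|) , mono i∸1≤m i≤m left , mono i<m i≤m right })
  (λ { ((2≤i , _) , left , right) → (2≤i , i<|τ|) , mono i≤m i∸1≤m left , mono i≤m i<m right })
  where
  i≤m : i ≤ m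
  i≤m = ≤-trans (n≤1+n i) i<m
  i∸1≤m : i ∸ 1 ≤ m
  i∸1≤m = ≤-trans (m∸n≤m i 1) i≤m
  i<|τ| : suc i ≤ length τ
  i<|τ| = ≤-trans i<m m≤|τ|

extend : ℕ → List ℕ → List ℕ
extend v σ = map (punchIn v) σ ∷ʳ v

length-extend : ∀ v σ → length (extend v σ) ≡ suc (length σ)
length-extend v σ = begin
  length (map (punchIn v) σ ++ [ v ]) ≡⟨ length-++ (map (punchIn v) σ) ⟩
  length (map (punchIn v) σ) + 1      ≡⟨ cong (_+ 1) (length-map (punchIn v) σ) ⟩
  length σ + 1                        ≡⟨ +-comm (length σ) 1 ⟩
  suc (length σ)                      ∎
  where open ≡-Reasoning

extend-injective : ∀ {v w σ τ} → extend v σ ≡ extend w τ → v ≡ w × σ ≡ τ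
extend-injective {v} {σ = σ} eq with map≡ , refl ← ∷ʳ-injective (map (punchIn v) σ) _ eq =
  refl , map-injective (punchIn-injective v) map≡

module _ {v} (1≤v : 1 ≤ v) (σ : List ℕ) where

  private
    |σ|≤|extend| : length σ ≤ length (extend v σ)
    |σ|≤|extend| = subst (length σ ≤_) (sym (length-extend v σ)) (n≤1+n (length σ))

    entry-extend : ∀ {j} → j ≤ length σ → entry (extend v σ) j ≡ punchIn v (entry σ j)
    entry-extend {j} j≤|σ| = trans
      (entry-++ˡ (map (punchIn v) σ) [ v ] (subst (j ≤_) (sym (length-map (punchIn v) σ)) j≤|σ|))
      (entry-map (punchIn-zero 1≤v) σ j)

  peakOrValley-extend⁺ : ∀ {i} → suc i ≤ length σ → PeakOrValley σ i → PeakOrValley (extend v σ) i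
  peakOrValley-extend⁺ = peakOrValley-transport σ (extend v σ) (length σ) |σ|≤|extend|
    (λ j≤ k≤ lt → subst₂ _<_ (sym (entry-extend j≤)) (sym (entry-extend k≤)) (punchIn-mono-< v lt))

  peakOrValley-extend⁻ : ∀ {i} → suc i ≤ length σ → PeakOrValley (extend v σ) i → PeakOrValley σ i
  peakOrValley-extend⁻ = peakOrValley-transport (extend v σ) σ (length σ) ≤-refl
    (λ j≤ k≤ lt → punchIn-cancel-< v (subst₂ _<_ (entry-extend j≤) (entry-extend k≤) lt))

  peaksValleysEven-extend⁻ : PeaksValleysEven (extend v σ) → PeaksValleysEven σ
  peaksValleysEven-extend⁻ pvEven i pv =
    pvEven i (peakOrValley-extend⁺ (proj₂ (peakOrValley⇒interior {σ} pv)) pv)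

  peaksValleysEven-extend⁺ : Even (length σ) → PeaksValleysEven σ → PeaksValleysEven (extend v σ)
  peaksValleysEven-extend⁺ |σ|-even pvEven i pv with i ≟ length σ
  ... | yes refl = |σ|-even
  ... | no  i≢|σ| = pvEven i (peakOrValley-extend⁻ (≤∧≢⇒< i≤|σ| i≢|σ|) pv)
    where
    i≤|σ| : i ≤ length σ
    i≤|σ| = ≤-pred (subst (suc i ≤_) (length-extend v σ)
                          (proj₂ (peakOrValley⇒interior {extend v σ} pv)))

extend-∈-pvEvenPerms : ∀ {m v σ} → Even m → v ∈ range (suc m) → σ ∈ pvEvenPerms m →
                       extend v σ ∈ pvEvenPerms (suc m)
extend-∈-pvEvenPerms {v = v} {σ} m-even v∈ σ∈ with (|σ| , σ⊆ , σ!) , pvEven ← ∈-pvEvenPerms⁻ σ∈ =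
  ∈-pvEvenPerms⁺
    ( trans (length-extend v σ) (cong suc |σ|)
    , All.∷ʳ⁺ (All.map⁺ (All.map (punchIn-∈-range v) σ⊆)) v∈
    , unique-∷ʳ⁺ (Unique.map⁺ (punchIn-injective v) σ!)
                 (All.map⁺ (All.universal (punchInᵥ≢v v) σ)) )
    (peaksValleysEven-extend⁺ 1≤v σ (subst Even (sym |σ|) m-even) pvEven)
  where
  1≤v : 1 ≤ v
  1≤v = proj₁ (∈-range⁻ v∈)

extend-surjective : ∀ {m π} → π ∈ pvEvenPerms (suc m) →
                    ∃₂ λ v σ → v ∈ range (suc m) × σ ∈ pvEvenPerms m × π ≡ extend v σ
extend-surjective {m} {π} π∈ with (|π| , π⊆ , π!) , pvEven ← ∈-pvEvenPerms⁻ π∈ | initLast π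
... | xs ∷ʳ′ v
  with xs⊆ , v∈ ← All.∷ʳ⁻ π⊆ | xs! , xs≢v ← unique-∷ʳ⁻ xs π! =
  v , σ , v∈ , ∈-pvEvenPerms⁺ (|σ| , σ⊆ , σ!) σ-pvEven , π≡
  where
  σ : List ℕ
  σ = map (punchOut v) xs
  π≡ : xs ∷ʳ v ≡ extend v σ
  π≡ = cong (_∷ʳ v) (sym (map-punchIn-punchOut xs≢v))
  |σ| : length σ ≡ m
  |σ| = suc-injective (trans (sym (length-extend v σ)) (trans (cong length (sym π≡)) |π|))
  σ⊆ : All (_∈ range m) σ
  σ⊆ = All.map⁺ (All.zipWith (λ (x∈ , x≢v) → punchOut-∈-range v∈ x∈ x≢v) (xs⊆ , xs≢v))
  σ! : Unique σ
  σ! = Unique.map⁻ (subst Unique (sym (map-punchIn-punchOut xs≢v)) xs!)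
  σ-pvEven : PeaksValleysEven σ
  σ-pvEven = peaksValleysEven-extend⁻ (proj₁ (∈-range⁻ v∈)) σ (subst PeaksValleysEven π≡ pvEven)

∈-pvEvenPerms-suc⇔ : ∀ {m π} → Even m →
  π ∈ pvEvenPerms (suc m) ⇔ π ∈ cartesianProductWith extend (range (suc m)) (pvEvenPerms m)
∈-pvEvenPerms-suc⇔ {m} m-even = mk⇔
  (λ π∈ → let v , σ , v∈ , σ∈ , π≡ = extend-surjective {m} π∈ in
          subst (_∈ cartesianProductWith extend (range (suc m)) (pvEvenPerms m)) (sym π≡)
            (∈-cartesianProductWith⁺ extend v∈ σ∈))
  (λ π∈ → let v , σ , v∈ , σ∈ , π≡ =
                ∈-cartesianProductWith⁻ extend (range (suc m)) (pvEvenPerms m) π∈ in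
          subst (_∈ pvEvenPerms (suc m)) (sym π≡) (extend-∈-pvEvenPerms m-even v∈ σ∈))

b-suc-even : ∀ m → Even m → b (suc m) ≡ suc m * b m
b-suc-even m m-even = begin
  b (suc m)
    ≡⟨ length-cong-unique (pvEvenPerms-unique (suc m)) pairs-unique (∈-pvEvenPerms-suc⇔ m-even) ⟩
  length (cartesianProductWith extend (range (suc m)) (pvEvenPerms m))
    ≡⟨ length-cartesianProductWith extend (range (suc m)) (pvEvenPerms m) ⟩
  length (range (suc m)) * b m
    ≡⟨ cong (_* b m) (length-range (suc m)) ⟩
  suc m * b m ∎
  where
  open ≡-Reasoning
  pairs-unique : Unique (cartesianProductWith extend (range (suc m)) (pvEvenPerms m))
  pairs-unique = Unique.cartesianProductWith⁺ extend extend-injective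
                   (range-unique (suc m)) (pvEvenPerms-unique m)

proposition5 : (n : ℕ) → b (suc (2 * n)) ≡ suc (2 * n) * b (2 * n)
proposition5 n = b-suc-even (2 * n) (m∣m*n n)
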